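{- For every integer $n\ge 1$, the $n$-dimensional hypercube $Q_n$ satisfies $S(Q_n)=2n-1$.
   Context: For a finite simple graph $G=(V,E)$ and an injective map $f:V\to\mathbb Z$, let $\sigma(G,f)=\{f(v)+f(w): vw\in E\}$. The sum index of $G$ is $S(G)=\min_{f}|\sigma(G,f)|$ over all injective $f:V\to\mathbb Z$. $Q_1$ is the graph with two vertices joined by an edge, and $Q_n=Q_{n-1}\,\square\, P_2$ is obtained by taking two copies of $Q_{n-1}$ and joining each vertex to its copy. -}

module Defs where

open import Data.Nat using (ℕ; zero; suc)
open import Data.Bool using (Bool)
open import Data.Vec using (Vec; []; _∷_)
open import Data.Integer using (ℤ; _+_)
open import Data.List using (List; length)
open import Data.List.Relation.Unary.Unique.Propositional using (Unique)
open import Data.List.Membership.Propositional using (_∈_)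
open import Data.Product using (Σ; _×_; ∃; ∃-syntax)
open import Data.Sum using (_⊎_)
open import Data.Empty using (⊥)
open import Function.Bundles using (_⇔_)
open import Function.Definitions using (Injective)
open import Relation.Binary.PropositionalEquality using (_≡_; _≢_)
open import Relation.Nullary using (¬_)

-- Edges vw correspond to (ordered) pairs with Adj v w; since Adj is symmetric,
-- the set of edge sums is the same whether ordered or unordered pairs are used.

-- Q 0 is a single vertex (no edges); Q (suc n) = Q n □ P₂, where the new
-- coordinate (head of the vector) records which copy of Q n the vertex lies in.
QAdj : (n : ℕ) → Vec Bool n → Vec Bool n → Set
QAdj zero    []      []      = ⊥
QAdj (suc n) (b ∷ u) (c ∷ v) = (b ≡ c × QAdj n u v) ⊎ (b ≢ c × u ≡ v)

InSumSet : {V : Set} → (V → V → Set) → (V → ℤ) → ℤ → Set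
InSumSet {V} Adj f s = Σ V λ v → Σ V λ w → Adj v w × s ≡ f v + f w

SumSetSize : {V : Set} → (V → V → Set) → (V → ℤ) → ℕ → Set
SumSetSize Adj f k =
  Σ (List ℤ) λ L → Unique L × length L ≡ k × (∀ s → (s ∈ L) ⇔ InSumSet Adj f s)

SumIndexIs : {V : Set} → (V → V → Set) → ℕ → Set
SumIndexIs {V} Adj k =
  (Σ (V → ℤ) λ f → Injective _≡_ _≡_ f × SumSetSize Adj f k)
  × (∀ (f : V → ℤ) → Injective _≡_ _≡_ f → ∀ m → SumSetSize Adj f m → k Data.Nat.≤ m)

{-# OPTIONS --safe #-}
module Submission where

-- Lower bound, valid in any graph of minimum degree d: if f is injective with its minimum at lo
-- and its maximum at hi, the d sums f lo + f w over the neighbours w of lo are distinct and at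
-- most f lo + f hi, while the d sums at hi are distinct and at least f lo + f hi. The two families
-- share at most that one value, so there are at least 2d − 1 sums; in Q n every degree is n.
--
-- Upper bound: label the vertex b ∷ u of Q (n + 1) by ±(2 · value u + 1) = ±value (true ∷ u),
-- where value is the binary value and the sign is the parity of b ∷ u. Adjacent vertices have
-- opposite parities, so an edge sum is ± twice the difference of the values of the tails: 0 across
-- the first coordinate and ±2^(i+1) along coordinate i + 1. The sums are 0, ±2, …, ±2^n.

open import Defs
open import Algebra.Bundles using (AbelianGroup)
open import Data.Bool using (Bool; true; false; not; _xor_)
open import Data.Bool.Properties
  using (not-¬; ¬-not; not-distribˡ-xor; not-distribʳ-xor; xor-same)
open import Data.Empty using (⊥-elim)
open import Data.Fin using (Fin; zero; suc; splitAt; join)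
open import Data.Fin.Properties using (injective⇒≤; join-splitAt; 0≢1+n)
open import Data.Integer as ℤ using (ℤ; +_; -_; _-_; 0ℤ; 1ℤ; -1ℤ; ∣_∣)
import Data.Integer.Properties as ℤ
open import Data.Integer.Tactic.RingSolver using (solve-∀)
open import Data.List using (List; []; _∷_; length; lookup; map)
open import Data.List.Membership.Propositional using (_∈_; _∉_)
open import Data.List.Membership.Propositional.Properties using (∈-map⁺; ∈-map⁻)
open import Data.List.Properties using (length-map)
open import Data.List.Relation.Unary.All using (_∷_)
open import Data.List.Relation.Unary.All.Properties using (¬Any⇒All¬)
open import Data.List.Relation.Unary.Any using (here; there; index)
open import Data.List.Relation.Unary.Any.Properties using (lookup-index)
open import Data.List.Relation.Unary.AllPairs using ([]; _∷_)
open import Data.List.Relation.Unary.Unique.Propositional using (Unique)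
import Data.List.Relation.Unary.Unique.Propositional.Properties as Unique
open import Data.Nat using (ℕ; zero; suc; _+_; _≤_; _*_; _∸_)
open import Data.Nat.DivMod using (_%_; [m+kn]%n≡m%n)
import Data.Nat.Properties as ℕ
open import Data.Product using (∃-syntax; _×_; _,_)
open import Data.Sum using (_⊎_; inj₁; inj₂; [_,_])
open import Data.Vec using (Vec; []; _∷_; updateAt; replicate; tail)
open import Data.Vec.Properties using (∷-injectiveˡ; ∷-injectiveʳ)
open import Function using (_∘_)
open import Function.Bundles using (Equivalence; mk⇔)
open import Function.Definitions using (Injective)
open import Relation.Binary.Definitions using (DecidableEquality)
open import Relation.Binary.PropositionalEquality
  using (_≡_; _≢_; refl; sym; trans; cong; cong₂; subst; module ≡-Reasoning)
open import Relation.Nullary using (yes; no)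

open import Algebra.Properties.Group (AbelianGroup.group ℤ.+-0-abelianGroup)
  using () renaming (∙-cancelˡ to +-cancelˡ)

module _ {A : Set} (_≟_ : DecidableEquality A) where

  injective-pair⇒a+b≤1+length :
    (L : List A) (c : A) {a b : ℕ} (x : Fin a → A) (y : Fin b → A) →
    Injective _≡_ _≡_ x → Injective _≡_ _≡_ y → (∀ i j → x i ≡ y j → y j ≡ c) →
    (∀ i → x i ∈ L) → (∀ j → y j ∈ L) → a + b ≤ suc (length L)
  injective-pair⇒a+b≤1+length L c {a} {b} x y x-inj y-inj meet x∈L y∈L =
    injective⇒≤ {f = position ∘ splitAt a} (splitAt-injective ∘ position-injective)
    where
    splitAt-injective : Injective _≡_ _≡_ (splitAt a {b})
    splitAt-injective {i} {j} e =
      trans (sym (join-splitAt a b i)) (trans (cong (join a b) e) (join-splitAt a b j))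

    -- Positions in c ∷ L: the value c, the only one the two families may share, gets the head.
    slot : ∀ {v} → v ∈ L → Fin (suc (length L))
    slot {v} p with v ≟ c
    ... | yes _ = zero
    ... | no  _ = suc (index p)

    lookup-slot : ∀ {v} (p : v ∈ L) → lookup (c ∷ L) (slot p) ≡ v
    lookup-slot {v} p with v ≟ c
    ... | yes v≡c = sym v≡c
    ... | no  _   = sym (lookup-index p)

    slot-c : ∀ {v} (p : v ∈ L) → v ≡ c → slot p ≡ zero
    slot-c {v} p v≡c with v ≟ c
    ... | yes _   = refl
    ... | no  v≢c = ⊥-elim (v≢c v≡c)

    position : Fin a ⊎ Fin b → Fin (suc (length L))
    position (inj₁ i) = suc (index (x∈L i))
    position (inj₂ j) = slot (y∈L j)

    lookup-position : ∀ k → lookup (c ∷ L) (position k) ≡ [ x , y ] k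
    lookup-position (inj₁ i) = sym (lookup-index (x∈L i))
    lookup-position (inj₂ j) = lookup-slot (y∈L j)

    same-value : ∀ k l → position k ≡ position l → [ x , y ] k ≡ [ x , y ] l
    same-value k l e =
      trans (sym (lookup-position k)) (trans (cong (lookup (c ∷ L)) e) (lookup-position l))

    position-inj₁≢inj₂ : ∀ i j → position (inj₁ i) ≢ position (inj₂ j)
    position-inj₁≢inj₂ i j e =
      0≢1+n (trans (sym (slot-c (y∈L j) (meet i j (same-value (inj₁ i) (inj₂ j) e)))) (sym e))

    position-injective : Injective _≡_ _≡_ position
    position-injective {inj₁ i} {inj₁ j} e = cong inj₁ (x-inj (same-value (inj₁ i) (inj₁ j) e))
    position-injective {inj₂ i} {inj₂ j} e = cong inj₂ (y-inj (same-value (inj₂ i) (inj₂ j) e))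
    position-injective {inj₁ i} {inj₂ j} e = ⊥-elim (position-inj₁≢inj₂ i j e)
    position-injective {inj₂ j} {inj₁ i} e = ⊥-elim (position-inj₁≢inj₂ i j (sym e))

2δ∸1≤sumSetSize :
  {V : Set} {Adj : V → V → Set} {f : V → ℤ} → Injective _≡_ _≡_ f →
  {lo hi : V} → (∀ v → f lo ℤ.≤ f v) → (∀ v → f v ℤ.≤ f hi) →
  {d : ℕ} (α β : Fin d → V) → Injective _≡_ _≡_ α → Injective _≡_ _≡_ β →
  (∀ i → Adj lo (α i)) → (∀ i → Adj hi (β i)) →
  ∀ {m} → SumSetSize Adj f m → 2 * d ∸ 1 ≤ m
2δ∸1≤sumSetSize {f = f} f-inj {lo} {hi} lo-min hi-max {d} α β α-inj β-inj lo~α hi~β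
                (L , _ , refl , L⇔σ) =
  ℕ.∸-monoˡ-≤ 1 (subst (_≤ suc (length L)) (cong (_+_ d) (sym (ℕ.+-identityʳ d)))
    (injective-pair⇒a+b≤1+length ℤ._≟_ L c x y x-inj y-inj meet x∈L y∈L))
  where
  c : ℤ
  c = f lo ℤ.+ f hi
  x : Fin d → ℤ
  x i = f lo ℤ.+ f (α i)
  y : Fin d → ℤ
  y j = f hi ℤ.+ f (β j)

  x-inj : Injective _≡_ _≡_ x
  x-inj = α-inj ∘ f-inj ∘ +-cancelˡ (f lo) _ _
  y-inj : Injective _≡_ _≡_ y
  y-inj = β-inj ∘ f-inj ∘ +-cancelˡ (f hi) _ _

  x≤c : ∀ i → x i ℤ.≤ c
  x≤c i = ℤ.+-monoʳ-≤ (f lo) (hi-max (α i))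
  c≤y : ∀ j → c ℤ.≤ y j
  c≤y j = subst (c ℤ.≤_) (ℤ.+-comm (f (β j)) (f hi)) (ℤ.+-monoˡ-≤ (f hi) (lo-min (β j)))

  meet : ∀ i j → x i ≡ y j → y j ≡ c
  meet i j e = ℤ.≤-antisym (subst (ℤ._≤ c) e (x≤c i)) (c≤y j)

  x∈L : ∀ i → x i ∈ L
  x∈L i = Equivalence.from (L⇔σ _) (lo , α i , lo~α i , refl)
  y∈L : ∀ j → y j ∈ L
  y∈L j = Equivalence.from (L⇔σ _) (hi , β j , hi~β j , refl)

toggle : ∀ {n} → Fin n → Vec Bool n → Vec Bool n
toggle i v = updateAt v i not

toggle-adjacent : ∀ {n} (i : Fin n) (v : Vec Bool n) → QAdj n v (toggle i v)
toggle-adjacent zero    (b ∷ u) = inj₂ (not-¬ refl , refl)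
toggle-adjacent (suc i) (b ∷ u) = inj₁ (refl , toggle-adjacent i u)

toggle-injective : ∀ {n} (v : Vec Bool n) → Injective _≡_ _≡_ (λ i → toggle i v)
toggle-injective (b ∷ u) {zero}  {zero}  _ = refl
toggle-injective (b ∷ u) {zero}  {suc j} e = ⊥-elim (not-¬ refl (sym (∷-injectiveˡ e)))
toggle-injective (b ∷ u) {suc i} {zero}  e = ⊥-elim (not-¬ refl (∷-injectiveˡ e))
toggle-injective (b ∷ u) {suc i} {suc j} e = cong suc (toggle-injective u (∷-injectiveʳ e))

argmax : ∀ {n} (f : Vec Bool n → ℤ) → ∃[ v ] ∀ w → f w ℤ.≤ f v
argmax {zero}  f = [] , λ { [] → ℤ.≤-refl }
argmax {suc n} f with argmax (f ∘ (false ∷_)) | argmax (f ∘ (true ∷_))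
... | v₀ , v₀-max | v₁ , v₁-max with ℤ.≤-total (f (false ∷ v₀)) (f (true ∷ v₁))
... | inj₁ f₀≤f₁ = true ∷ v₁ , λ where
  (false ∷ w) → ℤ.≤-trans (v₀-max w) f₀≤f₁
  (true  ∷ w) → v₁-max w
... | inj₂ f₁≤f₀ = false ∷ v₀ , λ where
  (false ∷ w) → v₀-max w
  (true  ∷ w) → ℤ.≤-trans (v₁-max w) f₁≤f₀

argmin : ∀ {n} (f : Vec Bool n → ℤ) → ∃[ v ] ∀ w → f v ℤ.≤ f w
argmin f with argmax (-_ ∘ f)
... | v , v-max = v , λ w → ℤ.neg-cancel-≤ (v-max w)

2n∸1≤sumSetSize-QAdj : ∀ n (f : Vec Bool n → ℤ) → Injective _≡_ _≡_ f →
  ∀ {m} → SumSetSize (QAdj n) f m → 2 * n ∸ 1 ≤ m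
2n∸1≤sumSetSize-QAdj n f f-inj with argmin f | argmax f
... | lo , lo-min | hi , hi-max =
  2δ∸1≤sumSetSize f-inj lo-min hi-max (λ i → toggle i lo) (λ i → toggle i hi)
    (toggle-injective lo) (toggle-injective hi)
    (λ i → toggle-adjacent i lo) (λ i → toggle-adjacent i hi)

parity : ∀ {n} → Vec Bool n → Bool
parity []      = false
parity (b ∷ u) = b xor parity u

parity-adjacent : ∀ {n} {v w : Vec Bool n} → QAdj n v w → parity w ≡ not (parity v)
parity-adjacent {zero}  {[]}    {[]}     ()
parity-adjacent {suc n} {b ∷ u} {.b ∷ w} (inj₁ (refl , u~w)) =
  trans (cong (b xor_) (parity-adjacent u~w)) (sym (not-distribʳ-xor b (parity u)))
parity-adjacent {suc n} {b ∷ u} {c ∷ .u} (inj₂ (b≢c , refl)) =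
  trans (cong (_xor parity u) (¬-not (b≢c ∘ sym))) (sym (not-distribˡ-xor b (parity u)))

bit : Bool → ℕ
bit false = 0
bit true  = 1

bit-injective : Injective _≡_ _≡_ bit
bit-injective {false} {false} _ = refl
bit-injective {true}  {true}  _ = refl

value : ∀ {n} → Vec Bool n → ℕ
value []      = 0
value (b ∷ u) = bit b + value u * 2

value%2 : ∀ {n} b (u : Vec Bool n) → value (b ∷ u) % 2 ≡ bit b
value%2 false u = [m+kn]%n≡m%n 0 (value u) 2
value%2 true  u = [m+kn]%n≡m%n 1 (value u) 2

value-injective : ∀ {n} → Injective _≡_ _≡_ (value {n})
value-injective {x = []}    {[]}    _ = refl
value-injective {x = b ∷ u} {c ∷ w} e
  with bit-injective (trans (sym (value%2 b u)) (trans (cong (_% 2) e) (value%2 c w)))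
... | refl =
  cong (b ∷_) (value-injective (ℕ.*-cancelʳ-≡ _ _ 2 (ℕ.+-cancelˡ-≡ (bit b) _ _ e)))

double : ℤ → ℤ
double x = x ℤ.* + 2

double-injective : Injective _≡_ _≡_ double
double-injective = ℤ.*-cancelʳ-≡ _ _ (+ 2)

Δ : ∀ {n} → Vec Bool n → Vec Bool n → ℤ
Δ u w = + value u - + value w

Δ-∷ : ∀ {n} b (u w : Vec Bool n) → Δ (b ∷ u) (b ∷ w) ≡ double (Δ u w)
Δ-∷ b u w = begin
  + value (b ∷ u) - + value (b ∷ w)
    ≡⟨ cong₂ _-_ (+value-∷ u) (+value-∷ w) ⟩
  (+ bit b ℤ.+ + value u ℤ.* + 2) - (+ bit b ℤ.+ + value w ℤ.* + 2)
    ≡⟨ cancel-head (+ bit b) (+ value u) (+ value w) ⟩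
  double (Δ u w) ∎
  where
  open ≡-Reasoning
  +value-∷ : (v : Vec Bool _) → + value (b ∷ v) ≡ + bit b ℤ.+ + value v ℤ.* + 2
  +value-∷ v = trans (ℤ.pos-+ (bit b) _) (cong (ℤ._+_ (+ bit b)) (ℤ.pos-* (value v) 2))
  cancel-head : ∀ β x y → (β ℤ.+ x ℤ.* + 2) - (β ℤ.+ y ℤ.* + 2) ≡ (x - y) ℤ.* + 2
  cancel-head = solve-∀

Δ-true-false : ∀ {n} (u : Vec Bool n) → Δ (true ∷ u) (false ∷ u) ≡ 1ℤ
Δ-true-false u = succ-minus (+ value (false ∷ u))
  where
  succ-minus : ∀ x → (1ℤ ℤ.+ x) - x ≡ 1ℤ
  succ-minus = solve-∀

Δ-false-true : ∀ {n} (u : Vec Bool n) → Δ (false ∷ u) (true ∷ u) ≡ -1ℤ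
Δ-false-true u = minus-succ (+ value (false ∷ u))
  where
  minus-succ : ∀ x → x - (1ℤ ℤ.+ x) ≡ -1ℤ
  minus-succ = solve-∀

±powersOf2 : ℕ → List ℤ
±powersOf2 zero    = []
±powersOf2 (suc n) = 1ℤ ∷ -1ℤ ∷ map double (±powersOf2 n)

length-±powersOf2 : ∀ n → length (±powersOf2 n) ≡ 2 * n
length-±powersOf2 zero    = refl
length-±powersOf2 (suc n) =
  trans (cong (λ k → suc (suc k)) (trans (length-map double (±powersOf2 n)) (length-±powersOf2 n)))
    (sym (ℕ.*-suc 2 n))

odd∉map-double : ∀ {x} L → ∣ x ∣ ≡ 1 → x ∉ map double L
odd∉map-double L ∣x∣≡1 p with ∈-map⁻ double p
... | y , _ , refl with ℕ.m*n≡1⇒n≡1 ∣ y ∣ 2 (trans (sym (ℤ.abs-* y (+ 2))) ∣x∣≡1)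
... | ()

0∉±powersOf2 : ∀ n → 0ℤ ∉ ±powersOf2 n
0∉±powersOf2 (suc n) (there (there p)) with ∈-map⁻ double p
... | y , y∈ , 0≡2y = 0∉±powersOf2 n (subst (_∈ _) (double-injective (sym 0≡2y)) y∈)

±powersOf2-unique : ∀ n → Unique (±powersOf2 n)
±powersOf2-unique zero    = []
±powersOf2-unique (suc n) =
  ((λ ()) ∷ ¬Any⇒All¬ _ (odd∉map-double _ refl)) ∷ ¬Any⇒All¬ _ (odd∉map-double _ refl)
    ∷ Unique.map⁺ double-injective (±powersOf2-unique n)

neg-∈-±powersOf2 : ∀ {n x} → x ∈ ±powersOf2 n → - x ∈ ±powersOf2 n
neg-∈-±powersOf2 {suc n} (here refl)         = there (here refl)
neg-∈-±powersOf2 {suc n} (there (here refl)) = here refl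
neg-∈-±powersOf2 {suc n} (there (there p)) with ∈-map⁻ double p
... | y , y∈ , refl =
  there (there (subst (_∈ _) (sym (ℤ.neg-distribˡ-* y (+ 2)))
    (∈-map⁺ double (neg-∈-±powersOf2 y∈))))

Δ-adjacent-∈-±powersOf2 : ∀ {n} {u w : Vec Bool n} → QAdj n u w → Δ u w ∈ ±powersOf2 n
Δ-adjacent-∈-±powersOf2 {zero}  {[]}    {[]}     ()
Δ-adjacent-∈-±powersOf2 {suc n} {b ∷ u} {.b ∷ w} (inj₁ (refl , u~w)) =
  there (there (subst (_∈ _) (sym (Δ-∷ b u w))
    (∈-map⁺ double (Δ-adjacent-∈-±powersOf2 u~w))))
Δ-adjacent-∈-±powersOf2 {suc n} {true  ∷ u} {false ∷ .u} (inj₂ (_ , refl))   = here (Δ-true-false u)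
Δ-adjacent-∈-±powersOf2 {suc n} {false ∷ u} {true  ∷ .u} (inj₂ (_ , refl))   = there (here (Δ-false-true u))
Δ-adjacent-∈-±powersOf2 {suc n} {false ∷ u} {false ∷ .u} (inj₂ (b≢b , refl)) = ⊥-elim (b≢b refl)
Δ-adjacent-∈-±powersOf2 {suc n} {true  ∷ u} {true  ∷ .u} (inj₂ (b≢b , refl)) = ⊥-elim (b≢b refl)

∈-±powersOf2⇒Δ-adjacent : ∀ {n x} → x ∈ ±powersOf2 n → ∃[ u ] ∃[ w ] QAdj n u w × Δ u w ≡ x
∈-±powersOf2⇒Δ-adjacent {suc n} (here refl) =
  true ∷ z , false ∷ z , inj₂ ((λ ()) , refl) , Δ-true-false z
  where z = replicate n false
∈-±powersOf2⇒Δ-adjacent {suc n} (there (here refl)) =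
  false ∷ z , true ∷ z , inj₂ ((λ ()) , refl) , Δ-false-true z
  where z = replicate n false
∈-±powersOf2⇒Δ-adjacent {suc n} (there (there p)) with ∈-map⁻ double p
... | y , y∈ , refl with ∈-±powersOf2⇒Δ-adjacent y∈
... | u , w , u~w , refl = false ∷ u , false ∷ w , inj₁ (refl , u~w) , Δ-∷ false u w

signed : Bool → ℤ → ℤ
signed false x = x
signed true  x = - x

signed-+-not : ∀ p x y → signed p x ℤ.+ signed (not p) y ≡ signed p (x - y)
signed-+-not false x y = refl
signed-+-not true  x y =
  sym (trans (ℤ.neg-distrib-+ x (- y)) (cong (ℤ._+_ (- x)) (ℤ.neg-involutive y)))

signed-double : ∀ p x → signed p (double x) ≡ double (signed p x)
signed-double false x = refl
signed-double true  x = ℤ.neg-distribˡ-* x (+ 2)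

signed-suc-injective : ∀ p q {k l} → signed p (+ suc k) ≡ signed q (+ suc l) → p ≡ q × k ≡ l
signed-suc-injective false false e = refl , ℕ.suc-injective (ℤ.+-injective e)
signed-suc-injective true  true  e = refl , ℤ.-[1+-injective e

signed-∈-0∷±powersOf2 : ∀ p {n x} → x ∈ 0ℤ ∷ ±powersOf2 n → signed p x ∈ 0ℤ ∷ ±powersOf2 n
signed-∈-0∷±powersOf2 false x∈          = x∈
signed-∈-0∷±powersOf2 true  (here refl) = here refl
signed-∈-0∷±powersOf2 true  (there x∈)  = there (neg-∈-±powersOf2 x∈)

xor-cancelʳ : ∀ b c p → b xor p ≡ c xor p → b ≡ c
xor-cancelʳ false false p _ = refl
xor-cancelʳ true  true  p _ = refl
xor-cancelʳ false true  p e = ⊥-elim (not-¬ refl e)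
xor-cancelʳ true  false p e = ⊥-elim (not-¬ refl (sym e))

label : ∀ {n} → Vec Bool (suc n) → ℤ
label v@(_ ∷ u) = signed (parity v) (+ value (true ∷ u))

label-injective : ∀ {n} → Injective _≡_ _≡_ (label {n})
label-injective {x = b ∷ u} {c ∷ w} e
  with signed-suc-injective (b xor parity u) (c xor parity w) e
... | same-parity , same-magnitude
  with ∷-injectiveʳ (value-injective {x = true ∷ u} {true ∷ w} (cong suc same-magnitude))
... | refl = cong (_∷ u) (xor-cancelʳ b c (parity u) same-parity)

label-edge-sum : ∀ {n} {v w : Vec Bool (suc n)} → QAdj (suc n) v w →
  label v ℤ.+ label w ≡ double (signed (parity v) (Δ (tail v) (tail w)))
label-edge-sum {v = v@(_ ∷ u)} {w@(_ ∷ u′)} v~w = begin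
  label v ℤ.+ label w
    ≡⟨ cong (λ p → label v ℤ.+ signed p (+ value (true ∷ u′))) (parity-adjacent v~w) ⟩
  signed (parity v) (+ value (true ∷ u)) ℤ.+ signed (not (parity v)) (+ value (true ∷ u′))
    ≡⟨ signed-+-not (parity v) _ _ ⟩
  signed (parity v) (Δ (true ∷ u) (true ∷ u′))
    ≡⟨ cong (signed (parity v)) (Δ-∷ true u u′) ⟩
  signed (parity v) (double (Δ u u′))
    ≡⟨ signed-double (parity v) (Δ u u′) ⟩
  double (signed (parity v) (Δ u u′)) ∎
  where open ≡-Reasoning

Δ-tail-adjacent : ∀ {n} {v w : Vec Bool (suc n)} → QAdj (suc n) v w →
  Δ (tail v) (tail w) ∈ 0ℤ ∷ ±powersOf2 n
Δ-tail-adjacent {v = b ∷ u} {.b ∷ w} (inj₁ (refl , u~w)) = there (Δ-adjacent-∈-±powersOf2 u~w)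
Δ-tail-adjacent {v = b ∷ u} {c ∷ .u} (inj₂ (_ , refl))    = here (ℤ.+-inverseʳ (+ value u))

∈-0∷±powersOf2⇒even-edge : ∀ {n y} → y ∈ 0ℤ ∷ ±powersOf2 n →
  ∃[ v ] ∃[ w ] QAdj (suc n) v w × parity v ≡ false × Δ (tail v) (tail w) ≡ y
∈-0∷±powersOf2⇒even-edge {n} (here refl) =
  parity z ∷ z , not (parity z) ∷ z , inj₂ (not-¬ refl , refl) , xor-same (parity z) ,
  ℤ.+-inverseʳ (+ value z)
  where z = replicate n false
∈-0∷±powersOf2⇒even-edge (there y∈) with ∈-±powersOf2⇒Δ-adjacent y∈
... | u , w , u~w , refl =
  parity u ∷ u , parity u ∷ w , inj₁ (refl , u~w) , xor-same (parity u) , refl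

label-sumSetSize : ∀ n → SumSetSize (QAdj (suc n)) label (2 * suc n ∸ 1)
label-sumSetSize n =
  map double (0ℤ ∷ ±powersOf2 n) ,
  Unique.map⁺ double-injective (¬Any⇒All¬ _ (0∉±powersOf2 n) ∷ ±powersOf2-unique n) ,
  trans (length-map double (0ℤ ∷ ±powersOf2 n)) (trans (cong suc (length-±powersOf2 n))
    (sym (cong (_∸ 1) (ℕ.*-suc 2 n)))) ,
  λ s → mk⇔ sum-of-edge edge-sum-∈
  where
  sum-of-edge : ∀ {s} → s ∈ map double (0ℤ ∷ ±powersOf2 n) → InSumSet (QAdj (suc n)) label s
  sum-of-edge s∈ with ∈-map⁻ double s∈
  ... | y , y∈ , refl with ∈-0∷±powersOf2⇒even-edge y∈
  ... | v , w , v~w , even , refl =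
    v , w , v~w ,
    sym (trans (label-edge-sum v~w) (cong (λ p → double (signed p (Δ (tail v) (tail w)))) even))

  edge-sum-∈ : ∀ {s} → InSumSet (QAdj (suc n)) label s → s ∈ map double (0ℤ ∷ ±powersOf2 n)
  edge-sum-∈ (v , w , v~w , refl) =
    subst (_∈ _) (sym (label-edge-sum v~w))
      (∈-map⁺ double (signed-∈-0∷±powersOf2 (parity v) (Δ-tail-adjacent v~w)))

theorem2p4 : (n : ℕ) → 1 ≤ n → SumIndexIs (QAdj n) (2 * n ∸ 1)
theorem2p4 (suc n) _ =
  (label , label-injective , label-sumSetSize n) ,
  λ f f-inj _ → 2n∸1≤sumSetSize-QAdj (suc n) f f-inj
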